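{- Let $n\geq 2$. If $\mathcal{F}\subset 2^{[n]}$ is intersecting, then $\beta(\mathcal{F})\leq 2^{n-3}$.
   Context: $2^{[n]}$ is the power set of $[n]=\{1,\dots,n\}$. A family is intersecting if any two of its members have nonempty intersection. For $\mathcal{F}\subset 2^{[n]}$ and distinct $i,j\in[n]$, let $b_{ij}(\mathcal{F})=|\{F\in\mathcal{F}\colon i\in F,\ j\notin F\}|$; the sturdiness is $\beta(\mathcal{F})=\min_{1\leq i\neq j\leq n} b_{ij}(\mathcal{F})$. -}

module Defs where

open import Data.Nat using (ℕ; _⊓_)
open import Data.Fin using (Fin; _≟_)
open import Data.Fin.Subset using (Subset; _∈_; _∉_; _∩_; Nonempty)
open import Data.Fin.Subset.Properties using (_∈?_)
open import Data.List using (List; length; filter; allFin; concatMap; foldr; [])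
open import Data.List.Membership.Propositional renaming (_∈_ to _∈ₗ_)
open import Data.List.Relation.Unary.Unique.Propositional using (Unique)
open import Data.Product using (_×_; _,_)
open import Relation.Nullary using (¬_; Dec; yes; no)
open import Relation.Nullary.Decidable using (_×-dec_; ¬?)

record Family (n : ℕ) : Set where
  constructor family
  field
    members : List (Subset n)
    distinct : Unique members
open Family public

Intersecting : ∀ {n} → Family n → Set
Intersecting {n} 𝓕 = ∀ {A B : Subset n} → A ∈ₗ members 𝓕 → B ∈ₗ members 𝓕 → Nonempty (A ∩ B)

b : ∀ {n} → Family n → Fin n → Fin n → ℕ
b 𝓕 i j = length (filter (λ A → (i ∈? A) ×-dec ¬? (j ∈? A)) (members 𝓕))

distinctPairs : (n : ℕ) → List (Fin n × Fin n)
distinctPairs n = concatMap (λ i → concatMap (λ j → pick i j) (allFin n)) (allFin n)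
  where
  pick : Fin n → Fin n → List (Fin n × Fin n)
  pick i j with i ≟ j
  ... | yes _ = []
  ... | no _ = (i , j) Data.List.∷ []

-- β(F) = min over ordered pairs i ≠ j of b_ij(F).  The list of pairs is
-- nonempty whenever n ≥ 2 (the only case used); the value 0 for the empty
-- list is irrelevant there.
β : ∀ {n} → Family n → ℕ
β {n} 𝓕 = go (Data.List.map (λ p → b 𝓕 (Data.Product.proj₁ p) (Data.Product.proj₂ p)) (distinctPairs n))
  where
  go : List ℕ → ℕ
  go [] = 0
  go (x Data.List.∷ xs) = foldr _⊓_ x xs

-- Removing the coordinates 0 and 1, a set of 𝓕 containing 0 but not 1 is determined by its
-- trace on the remaining m = n − 2 points, and one containing 1 but not 0 by the complement
-- of its trace.  Two such sets meet only on the remaining points, so for an intersecting 𝓕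
-- no trace of the first kind equals a complemented trace of the second kind.  Hence
-- b₀₁ + b₁₀ counts distinct subsets of an m-set, so 2β ≤ b₀₁ + b₁₀ ≤ 2^(n−2).

module Submission where

open import Defs
open import Data.Nat using (ℕ; zero; suc; _+_; _*_; _^_; _≤_; _⊓_; z≤n; s≤s)
open import Data.Nat.Properties
  using (≤-refl; ≤-trans; m⊓n≤m; m⊓n≤n; +-mono-≤; *-monoʳ-≤; +-suc; +-identityʳ; *-assoc; *-distribˡ-+; *-distribʳ-+;
         module ≤-Reasoning)
open import Data.Bool using (not)
open import Data.Bool.Properties using (not-involutive)
open import Data.Fin using (Fin; zero; suc)
open import Data.Fin.Subset using (Subset; _∈_; _∉_; _∩_; ∁; Empty; inside; outside)
open import Data.Fin.Subset.Properties using (_∈?_; drop-there; x∈p∩q⁻; x∈∁p⇒x∉p)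
open import Data.Vec using ([]; _∷_; drop) renaming (here to vhere; there to vthere)
import Data.Vec.Properties as Vec
open import Data.List using (List; []; _∷_; length; filter; map; foldr; _++_)
open import Data.List.Properties using (length-map; length-++; map-∘; map-id-local)
open import Data.List.Membership.Propositional using () renaming (_∈_ to _∈ₗ_)
open import Data.List.Membership.Propositional.Properties using (∈-map⁺; ∈-map⁻; ∈-filter⁻; ∈-++⁺ʳ)
open import Data.List.Relation.Unary.Any using (here; there)
open import Data.List.Relation.Unary.All using (All; _∷_)
import Data.List.Relation.Unary.All as All
open import Data.List.Relation.Unary.All.Properties using (all-filter; All¬⇒¬Any; ¬Any⇒All¬)
open import Data.List.Relation.Unary.AllPairs using ([]; _∷_)
open import Data.List.Relation.Unary.Unique.Propositional using (Unique)
open import Data.List.Relation.Unary.Unique.Propositional.Properties as Unique using ()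
open import Data.Product using (_×_; _,_; proj₁; proj₂)
open import Relation.Nullary using (¬_; Dec; contradiction)
open import Relation.Nullary.Decidable using (_×-dec_; ¬?)
open import Relation.Binary.PropositionalEquality
open import Function using (_∘′_)

foldr-⊓-≤-∈ : ∀ {x y} xs → y ∈ₗ x ∷ xs → foldr _⊓_ x xs ≤ y
foldr-⊓-≤-∈ []       (here refl)         = ≤-refl
foldr-⊓-≤-∈ (z ∷ zs) (here refl)         = ≤-trans (m⊓n≤n z _) (foldr-⊓-≤-∈ zs (here refl))
foldr-⊓-≤-∈ (z ∷ zs) (there (here refl)) = m⊓n≤m z _
foldr-⊓-≤-∈ (z ∷ zs) (there (there p))   = ≤-trans (m⊓n≤n z _) (foldr-⊓-≤-∈ zs (there p))

β≤b : ∀ {n} (𝓕 : Family n) {i j : Fin n} → (i , j) ∈ₗ distinctPairs n → β 𝓕 ≤ b 𝓕 i j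
β≤b {n} 𝓕 ij∈ with map (λ p → b 𝓕 (proj₁ p) (proj₂ p)) (distinctPairs n)
                 | ∈-map⁺ (λ p → b 𝓕 (proj₁ p) (proj₂ p)) ij∈
... | x ∷ xs | bij∈ = foldr-⊓-≤-∈ xs bij∈

-- Row 0 of distinctPairs starts with (0 , 1), row 1 with (1 , 0).
01∈distinctPairs : ∀ {m} → (zero , suc zero) ∈ₗ distinctPairs (2 + m)
01∈distinctPairs = here refl

10∈distinctPairs : ∀ {m} → (suc zero , zero) ∈ₗ distinctPairs (2 + m)
10∈distinctPairs = there (∈-++⁺ʳ _ (here refl))

splitOnZero : ∀ {m} → List (Subset (suc m)) → List (Subset m) × List (Subset m)
splitOnZero []                    = [] , []
splitOnZero ((inside  ∷ p) ∷ ps) = p ∷ proj₁ (splitOnZero ps) , proj₂ (splitOnZero ps)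
splitOnZero ((outside ∷ p) ∷ ps) = proj₁ (splitOnZero ps) , p ∷ proj₂ (splitOnZero ps)

length-splitOnZero : ∀ {m} (ps : List (Subset (suc m))) →
  length ps ≡ length (proj₁ (splitOnZero ps)) + length (proj₂ (splitOnZero ps))
length-splitOnZero []                   = refl
length-splitOnZero ((inside  ∷ p) ∷ ps) = cong suc (length-splitOnZero ps)
length-splitOnZero ((outside ∷ p) ∷ ps) = trans (cong suc (length-splitOnZero ps)) (sym (+-suc _ _))

∈-splitOnZero₁ : ∀ {m} {p : Subset m} ps → p ∈ₗ proj₁ (splitOnZero ps) → (inside ∷ p) ∈ₗ ps
∈-splitOnZero₁ ((inside  ∷ q) ∷ ps) (here refl) = here refl
∈-splitOnZero₁ ((inside  ∷ q) ∷ ps) (there p∈)  = there (∈-splitOnZero₁ ps p∈)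
∈-splitOnZero₁ ((outside ∷ q) ∷ ps) p∈          = there (∈-splitOnZero₁ ps p∈)

∈-splitOnZero₂ : ∀ {m} {p : Subset m} ps → p ∈ₗ proj₂ (splitOnZero ps) → (outside ∷ p) ∈ₗ ps
∈-splitOnZero₂ ((outside ∷ q) ∷ ps) (here refl) = here refl
∈-splitOnZero₂ ((outside ∷ q) ∷ ps) (there p∈)  = there (∈-splitOnZero₂ ps p∈)
∈-splitOnZero₂ ((inside  ∷ q) ∷ ps) p∈          = there (∈-splitOnZero₂ ps p∈)

Unique-splitOnZero₁ : ∀ {m} (ps : List (Subset (suc m))) → Unique ps → Unique (proj₁ (splitOnZero ps))
Unique-splitOnZero₁ []                   []          = []
Unique-splitOnZero₁ ((inside  ∷ p) ∷ ps) (p∉ ∷ ps!) =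
  ¬Any⇒All¬ _ (All¬⇒¬Any p∉ ∘′ ∈-splitOnZero₁ ps) ∷ Unique-splitOnZero₁ ps ps!
Unique-splitOnZero₁ ((outside ∷ p) ∷ ps) (_  ∷ ps!) = Unique-splitOnZero₁ ps ps!

Unique-splitOnZero₂ : ∀ {m} (ps : List (Subset (suc m))) → Unique ps → Unique (proj₂ (splitOnZero ps))
Unique-splitOnZero₂ []                   []          = []
Unique-splitOnZero₂ ((outside ∷ p) ∷ ps) (p∉ ∷ ps!) =
  ¬Any⇒All¬ _ (All¬⇒¬Any p∉ ∘′ ∈-splitOnZero₂ ps) ∷ Unique-splitOnZero₂ ps ps!
Unique-splitOnZero₂ ((inside  ∷ p) ∷ ps) (_  ∷ ps!) = Unique-splitOnZero₂ ps ps!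

Unique⇒length≤2^ : ∀ m {ps : List (Subset m)} → Unique ps → length ps ≤ 2 ^ m
Unique⇒length≤2^ zero    {[]}          _                  = z≤n
Unique⇒length≤2^ zero    {_ ∷ []}      _                  = s≤s z≤n
Unique⇒length≤2^ zero    {[] ∷ [] ∷ _} (([]≢[] ∷ _) ∷ _) = contradiction refl []≢[]
Unique⇒length≤2^ (suc m) {ps}          ps! rewrite length-splitOnZero ps | +-identityʳ (2 ^ m) =
  +-mono-≤ (Unique⇒length≤2^ m (Unique-splitOnZero₁ ps ps!))
           (Unique⇒length≤2^ m (Unique-splitOnZero₂ ps ps!))

Unique-map⁺-retraction : ∀ {A B : Set} {f : A → B} (g : B → A) {xs : List A} →
  All (λ x → g (f x) ≡ x) xs → Unique xs → Unique (map f xs)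
Unique-map⁺-retraction g {xs} gf≡id xs! =
  Unique.map⁻ {f = g} (subst Unique (sym (trans (sym (map-∘ xs)) (map-id-local gf≡id))) xs!)

∁-injective : ∀ {n} {p q : Subset n} → ∁ p ≡ ∁ q → p ≡ q
∁-injective {p = p} {q} ∁p≡∁q = begin
  p                 ≡⟨ ∁-involutive p ⟨
  ∁ (∁ p)           ≡⟨ cong ∁ ∁p≡∁q ⟩
  ∁ (∁ q)           ≡⟨ ∁-involutive q ⟩
  q                 ∎
  where
  open ≡-Reasoning
  ∁-involutive : ∀ {n} (p : Subset n) → ∁ (∁ p) ≡ p
  ∁-involutive p =
    trans (sym (Vec.map-∘ not not p)) (trans (Vec.map-cong not-involutive p) (Vec.map-id p))

module _ {m : ℕ} where

  ∈-∉⇒≡inside∷outside : ∀ {A : Subset (2 + m)} → zero ∈ A → suc zero ∉ A →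
                        inside ∷ outside ∷ drop 2 A ≡ A
  ∈-∉⇒≡inside∷outside {inside ∷ outside ∷ R} _ _   = refl
  ∈-∉⇒≡inside∷outside {inside ∷ inside  ∷ R} _ 1∉ = contradiction (vthere vhere) 1∉

  ∉-∈⇒≡outside∷inside : ∀ {A : Subset (2 + m)} → zero ∉ A → suc zero ∈ A →
                        outside ∷ inside ∷ drop 2 A ≡ A
  ∉-∈⇒≡outside∷inside {outside ∷ inside ∷ R} _  _ = refl
  ∉-∈⇒≡outside∷inside {outside ∷ outside ∷ R} _  (vthere ())
  ∉-∈⇒≡outside∷inside {inside  ∷ _       ∷ R} 0∉ _ = contradiction vhere 0∉

  Empty-∩-complementary : ∀ {A B : Subset (2 + m)} → suc zero ∉ A → zero ∉ B →
                          drop 2 A ≡ ∁ (drop 2 B) → Empty (A ∩ B)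
  Empty-∩-complementary {A@(_ ∷ _ ∷ _)} {B@(_ ∷ _ ∷ _)} 1∉A 0∉B tails (x , x∈A∩B)
    with x∈p∩q⁻ A B x∈A∩B
  Empty-∩-complementary _   0∉B _     (zero        , _) | _   , x∈B = 0∉B x∈B
  Empty-∩-complementary 1∉A _   _     (suc zero    , _) | x∈A , _   = 1∉A x∈A
  Empty-∩-complementary _   _   tails (suc (suc k) , _) | x∈A , x∈B =
    x∈∁p⇒x∉p (subst (k ∈_) tails (drop-there (drop-there x∈A))) (drop-there (drop-there x∈B))

module _ {m : ℕ} (𝓕 : Family (2 + m)) (𝓕-intersecting : Intersecting 𝓕) where
  private
    separates? : (i j : Fin (2 + m)) (A : Subset (2 + m)) → Dec (i ∈ A × ¬ j ∈ A)
    separates? i j A = (i ∈? A) ×-dec ¬? (j ∈? A)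

    F₀₁ F₁₀ : List (Subset (2 + m))
    F₀₁ = filter (separates? zero (suc zero)) (members 𝓕)
    F₁₀ = filter (separates? (suc zero) zero) (members 𝓕)

    T₀₁ T₁₀ : List (Subset m)
    T₀₁ = map (drop 2) F₀₁
    T₁₀ = map ∁ (map (drop 2) F₁₀)

    T₀₁! : Unique T₀₁
    T₀₁! = Unique-map⁺-retraction (λ R → inside ∷ outside ∷ R)
      (All.map (λ (0∈ , 1∉) → ∈-∉⇒≡inside∷outside 0∈ 1∉) (all-filter _ (members 𝓕)))
      (Unique.filter⁺ _ (distinct 𝓕))

    T₁₀! : Unique T₁₀
    T₁₀! = Unique.map⁺ ∁-injective (Unique-map⁺-retraction (λ R → outside ∷ inside ∷ R)
      (All.map (λ (1∈ , 0∉) → ∉-∈⇒≡outside∷inside 0∉ 1∈) (all-filter _ (members 𝓕)))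
      (Unique.filter⁺ _ (distinct 𝓕)))

    T₀₁-T₁₀-disjoint : ∀ {R} → ¬ (R ∈ₗ T₀₁ × R ∈ₗ T₁₀)
    T₀₁-T₁₀-disjoint (R∈T₀₁ , R∈T₁₀) with ∈-map⁻ (drop 2) R∈T₀₁ | ∈-map⁻ ∁ R∈T₁₀
    ... | A , A∈F₀₁ , refl | _ , R′∈ , tailA≡∁R′ with ∈-map⁻ (drop 2) R′∈
    ... | B , B∈F₁₀ , refl
        with ∈-filter⁻ (separates? zero (suc zero)) A∈F₀₁ | ∈-filter⁻ (separates? (suc zero) zero) B∈F₁₀
    ... | A∈𝓕 , _ , 1∉A | B∈𝓕 , _ , 0∉B =
      Empty-∩-complementary 1∉A 0∉B tailA≡∁R′ (𝓕-intersecting A∈𝓕 B∈𝓕)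

  b₀₁+b₁₀≤2^[n∸2] : b 𝓕 zero (suc zero) + b 𝓕 (suc zero) zero ≤ 2 ^ m
  b₀₁+b₁₀≤2^[n∸2] = begin
    length F₀₁ + length F₁₀                ≡⟨ cong₂ _+_ (length-map (drop 2) F₀₁) (length-map (drop 2) F₁₀) ⟨
    length T₀₁ + length (map (drop 2) F₁₀) ≡⟨ cong (length T₀₁ +_) (length-map ∁ (map (drop 2) F₁₀)) ⟨
    length T₀₁ + length T₁₀                ≡⟨ length-++ T₀₁ ⟨
    length (T₀₁ ++ T₁₀)                    ≤⟨ Unique⇒length≤2^ m (Unique.++⁺ T₀₁! T₁₀! T₀₁-T₁₀-disjoint) ⟩
    2 ^ m                                  ∎
    where open ≤-Reasoning

theorem1p8 : (n : ℕ) → 2 ≤ n → (𝓕 : Family n) → Intersecting 𝓕 →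
             8 * β 𝓕 ≤ 2 ^ n
theorem1p8 (suc zero) (s≤s ())
theorem1p8 (suc (suc m)) _ 𝓕 𝓕-intersecting = begin
  8 * β 𝓕                    ≡⟨ *-distribʳ-+ (β 𝓕) 4 4 ⟩
  4 * β 𝓕 + 4 * β 𝓕          ≡⟨ *-distribˡ-+ 4 (β 𝓕) (β 𝓕) ⟨
  4 * (β 𝓕 + β 𝓕)            ≤⟨ *-monoʳ-≤ 4 (+-mono-≤ (β≤b 𝓕 01∈distinctPairs) (β≤b 𝓕 10∈distinctPairs)) ⟩
  4 * (b₀₁ + b₁₀)            ≤⟨ *-monoʳ-≤ 4 (b₀₁+b₁₀≤2^[n∸2] 𝓕 𝓕-intersecting) ⟩
  4 * 2 ^ m                  ≡⟨ *-assoc 2 2 (2 ^ m) ⟩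
  2 ^ (2 + m)                ∎
  where
  open ≤-Reasoning
  b₀₁ b₁₀ : ℕ
  b₀₁ = b 𝓕 zero (suc zero)
  b₁₀ = b 𝓕 (suc zero) zero
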